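{- Let $p\ge1$ and $n\ge 3p+1$. With the sets $\mathcal{C}_j$ defined below for $\Delta_2^t(C_n^p)$ (vertex order $x_j=j$), $\mathcal{C}_{n-p+1}=\{\tau\}$, where $\tau=\{0,\dots,n-1\}\setminus\{0,n-2p,n-p\}$.
   Context: For a graph $G$, $\Delta_2^t(G)$ is the simplicial complex whose faces are the $\sigma\subseteq V(G)$ such that $V(G)\setminus\sigma$ contains two distinct non-adjacent vertices. $C_n^p$ has vertex set $\{0,\dots,n-1\}$ with distinct $u,v$ adjacent iff $v\equiv u\pm t\pmod n$ for some $1\le t\le p$. Given vertices $x_0,\dots,x_{n-1}$, set $\mathcal{C}_0=\Delta_2^t(G)$ and for $0\le j\le n-1$ put $\mathcal{M}_{x_j}=\{\{\sigma\setminus\{x_j\},\sigma\cup\{x_j\}\}\mid \sigma\setminus\{x_j\},\sigma\cup\{x_j\}\in\mathcal{C}_j\}$ and $\mathcal{C}_{j+1}=\{\sigma\in\mathcal{C}_j\mid \sigma\text{ lies in no pair of }\mathcal{M}_{x_j}\}$. Here $G=C_n^p$ and $x_j=j$. -}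

module Defs where

open import Data.Nat using (ℕ; zero; suc; _+_; _∸_; _≤_; _*_; _≡ᵇ_; NonZero)
open import Data.Nat.DivMod using (_%_)
open import Data.Fin using (Fin; toℕ)
open import Data.Fin.Subset using (Subset; inside; outside; _∉_)
open import Data.Vec using (tabulate)
import Data.Vec
open import Data.Bool using (if_then_else_; _∨_)
open import Data.Product using (Σ; _×_; ∃; ∃-syntax)
open import Data.Sum using (_⊎_)
open import Relation.Binary.PropositionalEquality using (_≡_; _≢_)
open import Relation.Nullary using (¬_)

Adj : (n p : ℕ) .{{_ : NonZero n}} → Fin n → Fin n → Set
Adj n p u v = u ≢ v × ∃[ t ] (1 ≤ t × t ≤ p ×
  (((toℕ u + t) % n ≡ toℕ v) ⊎ ((toℕ v + t) % n ≡ toℕ u)))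

Face : (n p : ℕ) .{{_ : NonZero n}} → Subset n → Set
Face n p σ = ∃[ u ] ∃[ v ] (u ∉ σ × v ∉ σ × u ≢ v × ¬ Adj n p u v)

-- σ ∖ {x} and σ ∪ {x} where x is the vertex with label x ∈ ℕ
-- (for x ≥ n these are just σ; only x < n is ever used below).
del : {n : ℕ} → ℕ → Subset n → Subset n
del x σ = tabulate λ i → if toℕ i ≡ᵇ x then outside else Data.Vec.lookup σ i

add : {n : ℕ} → ℕ → Subset n → Subset n
add x σ = tabulate λ i → if toℕ i ≡ᵇ x then inside else Data.Vec.lookup σ i

-- 𝒞_j for Δ_2^t(C_n^p) with vertex order x_j = j.
-- 𝒞_0 = Δ; σ ∈ 𝒞_{j+1} iff σ ∈ 𝒞_j and σ lies in no pair
-- {ρ∖{x_j}, ρ∪{x_j}} with both members in 𝒞_j; a pair containing σ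
-- is necessarily {σ∖{x_j}, σ∪{x_j}}.
𝒞 : (n p : ℕ) .{{_ : NonZero n}} → ℕ → Subset n → Set
𝒞 n p zero σ = Face n p σ
𝒞 n p (suc j) σ = 𝒞 n p j σ × ¬ (𝒞 n p j (del j σ) × 𝒞 n p j (add j σ))

τ : (n p : ℕ) → Subset n
τ n p = tabulate λ i →
  if (toℕ i ≡ᵇ 0) ∨ (toℕ i ≡ᵇ (n ∸ 2 * p)) ∨ (toℕ i ≡ᵇ (n ∸ p))
  then outside else inside

{-# OPTIONS --safe #-}
-- Read a subset through the labels it leaves out. For 1 ≤ j ≤ n − p, σ lies in 𝒞_j exactly when
-- its complement is either a Cluster: 0 plus labels in a window [M − p, M] with M ≥ j + p, one of
-- them not adjacent to 0; or a Triple: {0, i, i + p} with i < j and n ≤ i + 2p, plus possibly some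
-- labels in [n − p, i + p). For j = 1 this says that adding 0 destroys every non-adjacent pair.
-- From j to j + 1, the vertex j can be toggled inside a Cluster unless its window starts exactly
-- at j and no label beyond j is far from 0; then j itself is the far label and the Cluster is the
-- Triple with i = j. At j = n − p no Cluster remains, and a Triple survives the last round only if
-- n − p cannot be toggled, i.e. i = n − 2p, which is τ.
module Submission where

open import Defs
open import Data.Bool using (Bool; if_then_else_)
open import Data.Bool.Properties using (¬-not) renaming (_≟_ to _≟ᵇ_)
open import Data.Empty using (⊥; ⊥-elim)
open import Data.Fin using (Fin; toℕ; fromℕ<)
open import Data.Fin.Properties using (toℕ-injective; toℕ<n; toℕ-fromℕ<; any?)
open import Data.Fin.Subset using (Subset; inside; outside; _∉_)
open import Data.Nat
open import Data.Nat.DivMod using (_%_; m<n⇒m%n≡m; m≤n⇒[n∸m]%m≡n%m; [m+n]%n≡m%n)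
open import Data.Nat.Properties
open import Data.Product using (_×_; _,_; proj₁; proj₂; ∃-syntax)
open import Data.Sum using (_⊎_; inj₁; inj₂; [_,_])
open import Data.Vec using (tabulate; lookup)
open import Data.Vec.Properties
  using (lookup∘tabulate; tabulate∘lookup; tabulate-cong; []=⇒lookup; lookup⇒[]=)
open import Function using (_∘_; case_of_)
open import Function.Bundles using (_⇔_; mk⇔; Equivalence)
open import Function.Properties.Equivalence using () renaming (trans to ⇔-trans)
open import Relation.Binary.Definitions using (tri<; tri≈; tri>)
open import Relation.Binary.PropositionalEquality using (_≡_; _≢_; refl; sym; trans; cong; subst)
open import Relation.Nullary using (¬_; Dec; yes; no; does; contradiction)
open import Relation.Nullary.Decidable
  using (dec-true; dec-false; decidable-stable; _⊎-dec_; _×-dec_)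
open import Relation.Unary using (Decidable)

open Equivalence using (to; from)

record Out {n : ℕ} (σ : Subset n) (k : ℕ) : Set where
  constructor out
  field
    vertex : Fin n
    label  : toℕ vertex ≡ k
    absent : lookup σ vertex ≡ outside

-- In σ k holds vacuously for labels k ≥ n.
record In {n : ℕ} (σ : Subset n) (k : ℕ) : Set where
  constructor in′
  field
    present : ∀ u → toℕ u ≡ k → lookup σ u ≡ inside

module _ {n : ℕ} where

  private variable
    σ σ′ : Subset n
    j k : ℕ

  Out-In-disjoint : Out σ k → In σ k → ⊥
  Out-In-disjoint (out u refl u∉σ) (in′ present) =
    contradiction (trans (sym u∉σ) (present u refl)) λ ()

  Out⇒<n : Out σ k → k < n
  Out⇒<n (out u refl _) = toℕ<n u

  Out⇒lookup : Out σ k → (u : Fin n) → toℕ u ≡ k → lookup σ u ≡ outside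
  Out⇒lookup {σ = σ} (out v v≡k v∉σ) u u≡k =
    subst (λ w → lookup σ w ≡ outside) (toℕ-injective (trans v≡k (sym u≡k))) v∉σ

  In-all⊎Out-some : {P : ℕ → Set} → Decidable P → (σ : Subset n) →
                    (∀ k → P k → In σ k) ⊎ ∃[ k ] (P k × Out σ k)
  In-all⊎Out-some {P} P? σ with any? (λ u → P? (toℕ u) ×-dec (lookup σ u ≟ᵇ outside))
  ... | yes (u , Pu , u∉σ) = inj₂ (toℕ u , Pu , out u refl u∉σ)
  ... | no ∄ = inj₁ λ k Pk → in′ λ u u≡k → ¬-not λ u∉σ → ∄ (u , subst P (sym u≡k) Pk , u∉σ)

  In⊎Out : (σ : Subset n) (k : ℕ) → In σ k ⊎ Out σ k
  In⊎Out σ k with In-all⊎Out-some (_≟ k) σ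
  ... | inj₁ all-in = inj₁ (all-in k refl)
  ... | inj₂ (_ , refl , k∉σ) = inj₂ k∉σ

  ¬Out⇒In : ¬ Out σ k → In σ k
  ¬Out⇒In {σ = σ} {k} ¬out with In⊎Out σ k
  ... | inj₁ k∈σ = k∈σ
  ... | inj₂ k∉σ = contradiction k∉σ ¬out

  lastOut : (σ : Subset n) (m : ℕ) →
            (∀ k → n ≤ k + m → In σ k) ⊎ ∃[ M ] (Out σ M × ∀ k → M < k → In σ k)
  lastOut σ zero = inj₁ λ k n≤k+0 → in′ λ u u≡k →
    contradiction (subst (_< n) u≡k (toℕ<n u)) (≤⇒≯ (subst (n ≤_) (+-identityʳ k) n≤k+0))
  lastOut σ (suc m) with lastOut σ m
  ... | inj₂ last = inj₂ last
  ... | inj₁ above with In-all⊎Out-some (λ k → n ≤? k + suc m) σ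
  ...   | inj₁ above′ = inj₁ above′
  ...   | inj₂ (M , n≤M+1+m , M∉σ) = inj₂ (M , M∉σ , λ k M<k →
          above k (≤-trans n≤M+1+m (subst (_≤ k + m) (sym (+-suc M m)) (+-monoˡ-≤ m M<k))))

  Out-max : Out σ k → ∃[ M ] (Out σ M × k ≤ M × ∀ l → M < l → In σ l)
  Out-max {σ = σ} {k} k∉σ with lastOut σ n
  ... | inj₁ above = ⊥-elim (Out-In-disjoint k∉σ (above k (m≤n+m n k)))
  ... | inj₂ (M , M∉σ , above) =
        M , M∉σ , ≮⇒≥ (λ M<k → Out-In-disjoint k∉σ (above k M<k)) , above

  Subset-ext : (∀ u → lookup σ u ≡ lookup σ′ u) → σ ≡ σ′
  Subset-ext {σ = σ} {σ′} eq =
    trans (sym (tabulate∘lookup σ)) (trans (tabulate-cong eq) (tabulate∘lookup σ′))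

  -- does (m ≟ n) reduces to m ≡ᵇ n, so dec-true and dec-false decide the test in del and add.
  lookup-override-≡ : {b : Bool} (σ : Subset n) (u : Fin n) → toℕ u ≡ j →
    lookup (tabulate λ i → if toℕ i ≡ᵇ j then b else lookup σ i) u ≡ b
  lookup-override-≡ {j = j} {b} σ u u≡j = trans (lookup∘tabulate _ u)
    (cong (λ t → if t then b else lookup σ u) (dec-true (toℕ u ≟ j) u≡j))

  lookup-override-≢ : {b : Bool} (σ : Subset n) (u : Fin n) → toℕ u ≢ j →
    lookup (tabulate λ i → if toℕ i ≡ᵇ j then b else lookup σ i) u ≡ lookup σ u
  lookup-override-≢ {j = j} {b} σ u u≢j = trans (lookup∘tabulate _ u)
    (cong (λ t → if t then b else lookup σ u) (dec-false (toℕ u ≟ j) u≢j))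

  Out-del : Out σ k → Out (del j σ) k
  Out-del {σ = σ} {j = j} (out u refl u∉σ) with toℕ u ≟ j
  ... | yes u≡j = out u refl (lookup-override-≡ σ u u≡j)
  ... | no  u≢j = out u refl (trans (lookup-override-≢ σ u u≢j) u∉σ)

  Out-del-self : j < n → Out (del j σ) j
  Out-del-self {σ = σ} j<n =
    out (fromℕ< j<n) (toℕ-fromℕ< j<n) (lookup-override-≡ σ _ (toℕ-fromℕ< j<n))

  Out-add : Out σ k → k ≢ j → Out (add j σ) k
  Out-add {σ = σ} (out u refl u∉σ) u≢j = out u refl (trans (lookup-override-≢ σ u u≢j) u∉σ)

  Out-add⁻ : Out (add j σ) k → Out σ k × k ≢ j
  Out-add⁻ {j = j} {σ = σ} (out u refl u∉σ+j) with toℕ u ≟ j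
  ... | yes u≡j = contradiction (trans (sym u∉σ+j) (lookup-override-≡ σ u u≡j)) λ ()
  ... | no  u≢j = out u refl (trans (sym (lookup-override-≢ σ u u≢j)) u∉σ+j) , u≢j

  In-del : In σ k → k ≢ j → In (del j σ) k
  In-del {σ = σ} (in′ present) k≢j = in′ λ u u≡k →
    trans (lookup-override-≢ σ u (k≢j ∘ trans (sym u≡k))) (present u u≡k)

  In-add : In σ k → In (add j σ) k
  In-add {σ = σ} {j = j} (in′ present) = in′ λ u u≡k → case toℕ u ≟ j of λ where
    (yes u≡j) → lookup-override-≡ σ u u≡j
    (no u≢j)  → trans (lookup-override-≢ σ u u≢j) (present u u≡k)

  del-id : Out σ j → del j σ ≡ σ
  del-id {σ = σ} {j = j} j∉σ = Subset-ext λ u → case toℕ u ≟ j of λ where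
    (yes u≡j) → trans (lookup-override-≡ σ u u≡j) (sym (Out⇒lookup j∉σ u u≡j))
    (no u≢j)  → lookup-override-≢ σ u u≢j

  add-id : In σ j → add j σ ≡ σ
  add-id {σ = σ} {j = j} (in′ present) = Subset-ext λ u → case toℕ u ≟ j of λ where
    (yes u≡j) → trans (lookup-override-≡ σ u u≡j) (sym (present u u≡j))
    (no u≢j)  → lookup-override-≢ σ u u≢j

  excluding : {Q : ℕ → Set} → Decidable Q → Subset n
  excluding Q? = tabulate λ i → if does (Q? (toℕ i)) then outside else inside

  module _ {Q : ℕ → Set} (Q? : Decidable Q) where

    lookup-excluding-yes : (u : Fin n) → Q (toℕ u) → lookup (excluding Q?) u ≡ outside
    lookup-excluding-yes u Qu = trans (lookup∘tabulate _ u)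
      (cong (λ t → if t then outside else inside) (dec-true (Q? (toℕ u)) Qu))

    lookup-excluding-no : (u : Fin n) → ¬ Q (toℕ u) → lookup (excluding Q?) u ≡ inside
    lookup-excluding-no u ¬Qu = trans (lookup∘tabulate _ u)
      (cong (λ t → if t then outside else inside) (dec-false (Q? (toℕ u)) ¬Qu))

    Out-excluding : k < n → Q k → Out (excluding Q?) k
    Out-excluding k<n Qk = out (fromℕ< k<n) (toℕ-fromℕ< k<n)
      (lookup-excluding-yes _ (subst Q (sym (toℕ-fromℕ< k<n)) Qk))

    Out-excluding⁻ : Out (excluding Q?) k → Q k
    Out-excluding⁻ (out u refl u∉) = decidable-stable (Q? (toℕ u)) λ ¬Qu →
      contradiction (trans (sym u∉) (lookup-excluding-no u ¬Qu)) λ ()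

    In-excluding : ¬ Q k → In (excluding Q?) k
    In-excluding ¬Qk = in′ λ u u≡k → lookup-excluding-no u (¬Qk ∘ subst Q u≡k)

    ≡-excluding : (∀ k → Q k → Out σ k) → (∀ k → ¬ Q k → In σ k) → σ ≡ excluding Q?
    ≡-excluding out-Q in-¬Q = Subset-ext λ u → case Q? (toℕ u) of λ where
      (yes Qu)  → trans (Out⇒lookup (out-Q _ Qu) u refl) (sym (lookup-excluding-yes u Qu))
      (no ¬Qu) → trans (In.present (in-¬Q _ ¬Qu) u refl) (sym (lookup-excluding-no u ¬Qu))

module Adjacency (n p : ℕ) .{{_ : NonZero n}} (p≤n : p ≤ n) where

  private variable
    σ : Subset n

  -- For labels x < y: the cyclic distance between them is at most p.
  Close : ℕ → ℕ → Set
  Close x y = y ≤ x + p ⊎ x + n ≤ y + p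

  close? : ∀ x y → Dec (Close x y)
  close? x y = y ≤? x + p ⊎-dec x + n ≤? y + p

  [a+t]%n≡b⇒a+t≡b⊎b+n : ∀ {a t b} → a < n → t ≤ n → (a + t) % n ≡ b → a + t ≡ b ⊎ a + t ≡ b + n
  [a+t]%n≡b⇒a+t≡b⊎b+n {a} {t} {b} a<n t≤n [a+t]%n≡b with a + t <? n
  ... | yes a+t<n = inj₁ (trans (sym (m<n⇒m%n≡m a+t<n)) [a+t]%n≡b)
  ... | no a+t≮n = inj₂ (trans (sym (m∸n+n≡m n≤a+t)) (cong (_+ n) a+t∸n≡b))
    where
    n≤a+t : n ≤ a + t
    n≤a+t = ≮⇒≥ a+t≮n
    a+t∸n<n : a + t ∸ n < n
    a+t∸n<n = subst (a + t ∸ n <_) (m+n∸n≡m n n) (∸-monoˡ-< (+-mono-<-≤ a<n t≤n) n≤a+t)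
    a+t∸n≡b : a + t ∸ n ≡ b
    a+t∸n≡b = trans (sym (m<n⇒m%n≡m a+t∸n<n)) (trans (m≤n⇒[n∸m]%m≡n%m n≤a+t) [a+t]%n≡b)

  Adj⇒Close : {u v : Fin n} → toℕ u < toℕ v → Adj n p u v → Close (toℕ u) (toℕ v)
  Adj⇒Close {u} {v} u<v (_ , t , _ , t≤p , inj₁ [u+t]%n≡v)
    with [a+t]%n≡b⇒a+t≡b⊎b+n (toℕ<n u) (≤-trans t≤p p≤n) [u+t]%n≡v
  ... | inj₁ u+t≡v = inj₁ (subst (_≤ toℕ u + p) u+t≡v (+-monoʳ-≤ (toℕ u) t≤p))
  ... | inj₂ u+t≡v+n = contradiction u+t≡v+n (<⇒≢ (+-mono-<-≤ u<v (≤-trans t≤p p≤n)))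
  Adj⇒Close {u} {v} u<v (_ , t , _ , t≤p , inj₂ [v+t]%n≡u)
    with [a+t]%n≡b⇒a+t≡b⊎b+n (toℕ<n v) (≤-trans t≤p p≤n) [v+t]%n≡u
  ... | inj₁ v+t≡u = contradiction v+t≡u (>⇒≢ (<-≤-trans u<v (m≤m+n (toℕ v) t)))
  ... | inj₂ v+t≡u+n = inj₂ (subst (_≤ toℕ v + p) v+t≡u+n (+-monoʳ-≤ (toℕ v) t≤p))

  Close⇒Adj : {u v : Fin n} → toℕ u < toℕ v → Close (toℕ u) (toℕ v) → Adj n p u v
  Close⇒Adj {u} {v} u<v (inj₁ v≤u+p) =
    u≢v , toℕ v ∸ toℕ u , m<n⇒0<n∸m u<v , m≤n+o⇒m∸n≤o (toℕ v) (toℕ u) v≤u+p ,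
    inj₁ (trans (cong (_% n) (m+[n∸m]≡n (<⇒≤ u<v))) (m<n⇒m%n≡m (toℕ<n v)))
    where
    u≢v : u ≢ v
    u≢v = <⇒≢ u<v ∘ cong toℕ
  Close⇒Adj {u} {v} u<v (inj₂ u+n≤v+p) =
    u≢v , toℕ u + n ∸ toℕ v , m<n⇒0<n∸m v<u+n , m≤n+o⇒m∸n≤o (toℕ u + n) (toℕ v) u+n≤v+p ,
    inj₂ (trans (cong (_% n) (m+[n∸m]≡n (<⇒≤ v<u+n)))
                (trans ([m+n]%n≡m%n (toℕ u) n) (m<n⇒m%n≡m (toℕ<n u))))
    where
    u≢v : u ≢ v
    u≢v = <⇒≢ u<v ∘ cong toℕ
    v<u+n : toℕ v < toℕ u + n
    v<u+n = <-≤-trans (toℕ<n v) (m≤n+m n (toℕ u))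

  Adj-sym : {u v : Fin n} → Adj n p u v → Adj n p v u
  Adj-sym (u≢v , t , 1≤t , t≤p , inj₁ e) = u≢v ∘ sym , t , 1≤t , t≤p , inj₂ e
  Adj-sym (u≢v , t , 1≤t , t≤p , inj₂ e) = u≢v ∘ sym , t , 1≤t , t≤p , inj₁ e

  FarPair : Subset n → Set
  FarPair σ = ∃[ x ] ∃[ y ] (Out σ x × Out σ y × x < y × ¬ Close x y)

  Face⇔FarPair : ∀ σ → Face n p σ ⇔ FarPair σ
  Face⇔FarPair σ = mk⇔ Face⇒FarPair FarPair⇒Face
    where
    ∉⇒Out : ∀ {u} → u ∉ σ → Out σ (toℕ u)
    ∉⇒Out {u} u∉σ = out u refl (¬-not (u∉σ ∘ lookup⇒[]= u σ))

    outside⇒∉ : ∀ {u} → lookup σ u ≡ outside → u ∉ σ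
    outside⇒∉ u∉σ u∈σ = contradiction (trans (sym u∉σ) ([]=⇒lookup u∈σ)) λ ()

    Face⇒FarPair : Face n p σ → FarPair σ
    Face⇒FarPair (u , v , u∉σ , v∉σ , u≢v , ¬adj) with <-cmp (toℕ u) (toℕ v)
    ... | tri< u<v _ _ = _ , _ , ∉⇒Out u∉σ , ∉⇒Out v∉σ , u<v , ¬adj ∘ Close⇒Adj u<v
    ... | tri≈ _ u≡v _ = contradiction (toℕ-injective u≡v) u≢v
    ... | tri> _ _ v<u = _ , _ , ∉⇒Out v∉σ , ∉⇒Out u∉σ , v<u , ¬adj ∘ Adj-sym ∘ Close⇒Adj v<u

    FarPair⇒Face : FarPair σ → Face n p σ
    FarPair⇒Face (_ , _ , out u refl u∉σ , out v refl v∉σ , u<v , ¬close) =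
      u , v , outside⇒∉ u∉σ , outside⇒∉ v∉σ , <⇒≢ u<v ∘ cong toℕ , ¬close ∘ Adj⇒Close u<v

-- 𝒞 n p (suc j) is definitionally Unmatched (𝒞 n p j) j.
Unmatched : {n : ℕ} → (Subset n → Set) → ℕ → Subset n → Set
Unmatched S j σ = S σ × ¬ (S (del j σ) × S (add j σ))

Unmatched-cong : ∀ {n j} {σ : Subset n} {S S′ : Subset n → Set} →
                 (∀ ρ → S ρ ⇔ S′ ρ) → Unmatched S j σ ⇔ Unmatched S′ j σ
Unmatched-cong {σ = σ} S⇔S′ = mk⇔
  (λ (s , ¬both) → to (S⇔S′ σ) s ,
     λ (s′-del , s′-add) → ¬both (from (S⇔S′ _) s′-del , from (S⇔S′ _) s′-add))
  (λ (s′ , ¬both) → from (S⇔S′ σ) s′ ,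
     λ (s-del , s-add) → ¬both (to (S⇔S′ _) s-del , to (S⇔S′ _) s-add))

module Pruning (n p : ℕ) .{{_ : NonZero n}} (0<p : 0 < p) (3p<n : 3 * p < n) where

  p+p+p<n : p + p + p < n
  p+p+p<n = subst (_< n) (trans (cong (λ q → p + (p + q)) (+-identityʳ p)) (sym (+-assoc p p p)))
                    3p<n

  p<n : p < n
  p<n = ≤-<-trans (≤-trans (m≤m+n p p) (m≤m+n (p + p) p)) p+p+p<n

  open Adjacency n p (<⇒≤ p<n)

  private variable
    σ : Subset n
    j j′ k x : ℕ

  Far : ℕ → Set
  Far k = p < k × k + p < n

  far? : ∀ k → Dec (Far k)
  far? k = p <? k ×-dec k + p <? n

  ¬Close0⇒Far : ¬ Close 0 k → Far k
  ¬Close0⇒Far ¬close = ≰⇒> (¬close ∘ inj₁) , ≰⇒> (¬close ∘ inj₂)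

  Far⇒¬Close0 : Far k → ¬ Close 0 k
  Far⇒¬Close0 (p<k , _) (inj₁ k≤p) = <⇒≱ p<k k≤p
  Far⇒¬Close0 (_ , k+p<n) (inj₂ n≤k+p) = <⇒≱ k+p<n n≤k+p

  n≤i+p+p⇒p<i : ∀ {i} → n ≤ i + p + p → p < i
  n≤i+p+p⇒p<i {i} n≤i+p+p = ≰⇒> λ i≤p →
    <⇒≱ p+p+p<n (≤-trans n≤i+p+p (+-monoˡ-≤ p (+-monoˡ-≤ p i≤p)))

  record Cluster (j : ℕ) (σ : Subset n) : Set where
    field
      M c      : ℕ
      out-0    : Out σ 0
      out-M    : Out σ M
      out-c    : Out σ c
      far-c    : Far c
      j+p≤M    : j + p ≤ M
      in-below : ∀ k → 0 < k → k + p < M → In σ k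
      in-above : ∀ k → M < k → In σ k

  record Triple (j : ℕ) (σ : Subset n) : Set where
    field
      i         : ℕ
      i<j       : i < j
      n≤i+p+p   : n ≤ i + p + p
      i+p<n     : i + p < n
      out-0     : Out σ 0
      out-i     : Out σ i
      out-i+p   : Out σ (i + p)
      in-below  : ∀ k → 0 < k → k < i → In σ k
      in-middle : ∀ k → i < k → k + p < n → In σ k
      in-above  : ∀ k → i + p < k → In σ k

  open Cluster
  open Triple

  Shape : ℕ → Subset n → Set
  Shape j σ = Cluster j σ ⊎ Triple j σ

  Cluster-≤M : (a : Cluster j σ) → Out σ k → k ≤ M a
  Cluster-≤M a k∉σ = ≮⇒≥ λ M<k → Out-In-disjoint k∉σ (in-above a _ M<k)

  Cluster-M≤+p : (a : Cluster j σ) → Out σ k → 0 < k → M a ≤ k + p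
  Cluster-M≤+p a k∉σ 0<k = ≮⇒≥ λ k+p<M → Out-In-disjoint k∉σ (in-below a _ 0<k k+p<M)

  Triple-p<i : (b : Triple j σ) → p < i b
  Triple-p<i b = n≤i+p+p⇒p<i (n≤i+p+p b)

  Cluster-weaken : (a : Cluster j σ) → j′ + p ≤ M a → Cluster j′ σ
  Cluster-weaken a j′+p≤M = record
    { M = M a ; c = c a ; out-0 = out-0 a ; out-M = out-M a ; out-c = out-c a ; far-c = far-c a
    ; j+p≤M = j′+p≤M ; in-below = in-below a ; in-above = in-above a }

  Triple-weaken : (b : Triple j σ) → i b < j′ → Triple j′ σ
  Triple-weaken b i<j′ = record
    { i = i b ; i<j = i<j′ ; n≤i+p+p = n≤i+p+p b ; i+p<n = i+p<n b
    ; out-0 = out-0 b ; out-i = out-i b ; out-i+p = out-i+p b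
    ; in-below = in-below b ; in-middle = in-middle b ; in-above = in-above b }

  Triple⇒Cluster : (b : Triple j′ σ) → j ≤ i b → Cluster j σ
  Triple⇒Cluster b j≤i = record
    { M = i b + p ; c = i b ; out-0 = out-0 b ; out-M = out-i+p b ; out-c = out-i b
    ; far-c = Triple-p<i b , i+p<n b ; j+p≤M = +-monoˡ-≤ p j≤i
    ; in-below = λ k 0<k k+p<i+p → in-below b k 0<k (+-cancelʳ-< p k (i b) k+p<i+p)
    ; in-above = in-above b }

  Cluster-del : (a : Cluster j σ) → M a ≤ x + p → x ≤ M a → Cluster j (del x σ)
  Cluster-del a M≤x+p x≤M = record
    { M = M a ; c = c a
    ; out-0 = Out-del (out-0 a) ; out-M = Out-del (out-M a) ; out-c = Out-del (out-c a)
    ; far-c = far-c a ; j+p≤M = j+p≤M a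
    ; in-below = λ k 0<k k+p<M → In-del (in-below a k 0<k k+p<M)
                   λ k≡x → <⇒≱ k+p<M (subst (λ l → M a ≤ l + p) (sym k≡x) M≤x+p)
    ; in-above = λ k M<k → In-del (in-above a k M<k)
                   λ k≡x → <⇒≱ M<k (subst (_≤ M a) (sym k≡x) x≤M) }

  Cluster-add : ∀ {c′} (a : Cluster j σ) → Out σ c′ → Far c′ →
                x ≢ 0 → x ≢ M a → x ≢ c′ → Cluster j (add x σ)
  Cluster-add {c′ = c′} a c′∉σ far-c′ x≢0 x≢M x≢c′ = record
    { M = M a ; c = c′
    ; out-0 = Out-add (out-0 a) (x≢0 ∘ sym) ; out-M = Out-add (out-M a) (x≢M ∘ sym)
    ; out-c = Out-add c′∉σ (x≢c′ ∘ sym) ; far-c = far-c′ ; j+p≤M = j+p≤M a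
    ; in-below = λ k 0<k k+p<M → In-add (in-below a k 0<k k+p<M)
    ; in-above = λ k M<k → In-add (in-above a k M<k) }

  Triple-del : (b : Triple j σ) → i b < x → x < i b + p → n ≤ x + p → Triple j (del x σ)
  Triple-del b i<x x<i+p n≤x+p = record
    { i = i b ; i<j = i<j b ; n≤i+p+p = n≤i+p+p b ; i+p<n = i+p<n b
    ; out-0 = Out-del (out-0 b) ; out-i = Out-del (out-i b) ; out-i+p = Out-del (out-i+p b)
    ; in-below = λ k 0<k k<i → In-del (in-below b k 0<k k<i) (<⇒≢ (<-trans k<i i<x))
    ; in-middle = λ k i<k k+p<n →
        In-del (in-middle b k i<k k+p<n) (<⇒≢ (+-cancelʳ-< p k _ (<-≤-trans k+p<n n≤x+p)))
    ; in-above = λ k i+p<k → In-del (in-above b k i+p<k) (>⇒≢ (<-trans x<i+p i+p<k)) }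

  Triple-add : (b : Triple j σ) → i b < x → x < i b + p → Triple j (add x σ)
  Triple-add b i<x x<i+p = record
    { i = i b ; i<j = i<j b ; n≤i+p+p = n≤i+p+p b ; i+p<n = i+p<n b
    ; out-0 = Out-add (out-0 b) (<⇒≢ (≤-<-trans z≤n i<x))
    ; out-i = Out-add (out-i b) (<⇒≢ i<x) ; out-i+p = Out-add (out-i+p b) (>⇒≢ x<i+p)
    ; in-below = λ k 0<k k<i → In-add (in-below b k 0<k k<i)
    ; in-middle = λ k i<k k+p<n → In-add (in-middle b k i<k k+p<n)
    ; in-above = λ k i+p<k → In-add (in-above b k i+p<k) }

  Far⇒0< : Far k → 0 < k
  Far⇒0< (p<k , _) = ≤-<-trans z≤n p<k

  ¬FarPair-add0⇒Close : ¬ FarPair (add 0 σ) →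
                        ∀ {x y} → Out σ x → Out σ y → 0 < x → x < y → Close x y
  ¬FarPair-add0⇒Close ¬far x∉σ y∉σ 0<x x<y = decidable-stable (close? _ _) λ ¬close →
    ¬far (_ , _ , Out-add x∉σ (>⇒≢ 0<x) , Out-add y∉σ (>⇒≢ (<-trans 0<x x<y)) , x<y , ¬close)

  Cluster₁-intro : ∀ {c} → Out σ 0 → Out σ c → Far c → ¬ FarPair (add 0 σ) → Cluster 1 σ
  Cluster₁-intro {σ = σ} {c} 0∉σ c∉σ far-c ¬far with Out-max c∉σ
  ... | M , M∉σ , c≤M , above = record
    { M = M ; c = c ; out-0 = 0∉σ ; out-M = M∉σ ; out-c = c∉σ ; far-c = far-c
    ; j+p≤M = ≤-trans (proj₁ far-c) c≤M
    ; in-below = λ k 0<k k+p<M → ¬Out⇒In (no-low-out 0<k k+p<M) ; in-above = above }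
    where
    close : ∀ {x y} → Out σ x → Out σ y → 0 < x → x < y → Close x y
    close = ¬FarPair-add0⇒Close ¬far

    M≤c+p : M ≤ c + p
    M≤c+p with m≤n⇒m<n∨m≡n c≤M
    ... | inj₂ c≡M = subst (_≤ c + p) c≡M (m≤m+n c p)
    ... | inj₁ c<M with close c∉σ M∉σ (Far⇒0< far-c) c<M
    ...   | inj₁ M≤c+p = M≤c+p
    ...   | inj₂ c+n≤M+p = contradiction c+n≤M+p
            (<⇒≱ (subst (M + p <_) (+-comm n c) (+-mono-< (Out⇒<n M∉σ) (proj₁ far-c))))

    -- An out vertex k below the window would be close to both c and M, forcing 3p ≥ n.
    no-low-out : ∀ {k} → 0 < k → k + p < M → ¬ Out σ k
    no-low-out {k} 0<k k+p<M k∉σ with close k∉σ M∉σ 0<k (≤-<-trans (m≤m+n k p) k+p<M)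
    ... | inj₁ M≤k+p = <⇒≱ k+p<M M≤k+p
    ... | inj₂ k+n≤M+p = <⇒≱ (+-monoʳ-< k p+p+p<n) (begin
          k + n            ≤⟨ k+n≤M+p ⟩
          M + p            ≤⟨ +-monoˡ-≤ p M≤c+p ⟩
          c + p + p        ≤⟨ +-monoˡ-≤ p (+-monoˡ-≤ p c≤k+p) ⟩
          k + p + p + p    ≡⟨ trans (cong (_+ p) (+-assoc k p p)) (+-assoc k (p + p) p) ⟩
          k + (p + p + p)  ∎)
      where
      open ≤-Reasoning
      c≤k+p : c ≤ k + p
      c≤k+p with close k∉σ c∉σ 0<k (+-cancelʳ-< p k c (<-≤-trans k+p<M M≤c+p))
      ... | inj₁ c≤k+p = c≤k+p
      ... | inj₂ k+n≤c+p = contradiction (≤-trans (m≤n+m n k) k+n≤c+p) (<⇒≱ (proj₂ far-c))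

  FarPair⇒Cluster₁ : FarPair σ → ¬ FarPair (add 0 σ) → Cluster 1 σ
  FarPair⇒Cluster₁ (x , c , x∉σ , c∉σ , x<c , ¬close) ¬far with x ≟ 0
  ... | yes refl = Cluster₁-intro x∉σ c∉σ (¬Close0⇒Far ¬close) ¬far
  ... | no x≢0 = contradiction (¬FarPair-add0⇒Close ¬far x∉σ c∉σ (n≢0⇒n>0 x≢0) x<c) ¬close

  Cluster⇒FarPair : Cluster j σ → FarPair σ
  Cluster⇒FarPair a = 0 , c a , out-0 a , out-c a , Far⇒0< (far-c a) , Far⇒¬Close0 (far-c a)

  Cluster⇒¬FarPair-add0 : Cluster j σ → ¬ FarPair (add 0 σ)
  Cluster⇒¬FarPair-add0 a (x , y , x∉σ+0 , y∉σ+0 , _ , ¬close) with Out-add⁻ x∉σ+0 | Out-add⁻ y∉σ+0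
  ... | x∉σ , x≢0 | y∉σ , _ =
    ¬close (inj₁ (≤-trans (Cluster-≤M a y∉σ) (Cluster-M≤+p a x∉σ (n≢0⇒n>0 x≢0))))

  FarPair-del : FarPair σ → FarPair (del j σ)
  FarPair-del (x , y , x∉σ , y∉σ , x<y , ¬close) = x , y , Out-del x∉σ , Out-del y∉σ , x<y , ¬close

  𝒞₁⇔Shape : ∀ σ → 𝒞 n p 1 σ ⇔ Shape 1 σ
  𝒞₁⇔Shape σ = mk⇔
    (λ (face , ¬both) → inj₁ (FarPair⇒Cluster₁ (to (Face⇔FarPair σ) face) λ far+0 →
       ¬both ( from (Face⇔FarPair _) (FarPair-del (to (Face⇔FarPair σ) face))
             , from (Face⇔FarPair _) far+0)))
    λ where
      (inj₁ a) → from (Face⇔FarPair σ) (Cluster⇒FarPair a) , λ (_ , face+0) →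
                   Cluster⇒¬FarPair-add0 a (to (Face⇔FarPair _) face+0)
      (inj₂ b) → contradiction (≤-<-trans z≤n (Triple-p<i b)) (<⇒≱ (i<j b))

  Shape-down : Shape (suc j) σ → Shape j σ
  Shape-down (inj₁ a) = inj₁ (Cluster-weaken a (<⇒≤ (j+p≤M a)))
  Shape-down (inj₂ b) with m≤n⇒m<n∨m≡n (s≤s⁻¹ (i<j b))
  ... | inj₁ i<j = inj₂ (Triple-weaken b i<j)
  ... | inj₂ i≡j = inj₁ (Triple⇒Cluster b (≤-reflexive (sym i≡j)))

  Triple-add-blocked : (b : Triple j′ σ) → i b ≡ j → ¬ Shape j (add j σ)
  Triple-add-blocked {σ = σ} {j = j} b i≡j (inj₁ a) with Out-add⁻ (out-c a)
  ... | c∉σ , c≢j = Out-In-disjoint c∉σ (in-middle b _ i<c (proj₂ (far-c a)))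
    where
    j≤c : j ≤ c a
    j≤c = +-cancelʳ-≤ p j (c a) (≤-trans (j+p≤M a) (Cluster-M≤+p a (out-c a) (Far⇒0< (far-c a))))
    i<c : i b < c a
    i<c = subst (_< c a) (sym i≡j) (≤∧≢⇒< j≤c (c≢j ∘ sym))
  Triple-add-blocked b i≡j (inj₂ b′) with Out-add⁻ (out-i b′)
  ... | i′∉σ , _ = Out-In-disjoint i′∉σ
    (in-below b _ (≤-<-trans z≤n (Triple-p<i b′)) (subst (i b′ <_) (sym i≡j) (i<j b′)))

  module Step {j : ℕ} (0<j : 0 < j) (j+p<n : j + p < n) where

    j<n : j < n
    j<n = ≤-<-trans (m≤m+n j p) j+p<n

    Cluster-tight⇒Triple : (a : Cluster j σ) → M a ≡ j + p → Out σ j →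
                           (∀ k → j < k × Far k → In σ k) → Triple (suc j) σ
    Cluster-tight⇒Triple {σ = σ} a M≡j+p j∉σ no-far-beyond = record
      { i = j ; i<j = ≤-refl ; n≤i+p+p = n≤j+p+p ; i+p<n = j+p<n
      ; out-0 = out-0 a ; out-i = j∉σ ; out-i+p = subst (Out σ) M≡j+p (out-M a)
      ; in-below = λ k 0<k k<j → in-below a k 0<k (subst (k + p <_) (sym M≡j+p) (+-monoˡ-< p k<j))
      ; in-middle = λ k j<k k+p<n → no-far-beyond k (j<k , <-trans p<j j<k , k+p<n)
      ; in-above = λ k j+p<k → in-above a k (subst (_< k) (sym M≡j+p) j+p<k) }
      where
      p<j : p < j
      p<j with m≤n⇒m<n∨m≡n (+-cancelʳ-≤ p j (c a)
                 (subst (_≤ c a + p) M≡j+p (Cluster-M≤+p a (out-c a) (Far⇒0< (far-c a)))))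
      ... | inj₁ j<c =
            contradiction (no-far-beyond (c a) (j<c , far-c a)) (Out-In-disjoint (out-c a))
      ... | inj₂ j≡c = subst (p <_) (sym j≡c) (proj₁ (far-c a))
      n≤j+p+p : n ≤ j + p + p
      n≤j+p+p = ≮⇒≥ λ j+p+p<n → Out-In-disjoint (out-M a) (no-far-beyond (M a)
        ( subst (j <_) (sym M≡j+p) (m<m+n j 0<p)
        , subst (p <_) (sym M≡j+p) (m<n+m p 0<j)
        , subst (λ l → l + p < n) (sym M≡j+p) j+p+p<n))

    Cluster-tight : (a : Cluster j σ) → M a ≡ j + p →
                    ¬ (Shape j (del j σ) × Shape j (add j σ)) → Triple (suc j) σ
    Cluster-tight {σ = σ} a M≡j+p ¬both with In⊎Out σ j
    ... | inj₁ j∈σ = ⊥-elim (¬both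
          ( inj₁ (Cluster-del a (≤-reflexive M≡j+p) (subst (j ≤_) (sym M≡j+p) (m≤m+n j p)))
          , subst (Shape j) (sym (add-id j∈σ)) (inj₁ a)))
    ... | inj₂ j∉σ with In-all⊎Out-some (λ k → j <? k ×-dec far? k) σ
    ...   | inj₁ no-far-beyond = Cluster-tight⇒Triple a M≡j+p j∉σ no-far-beyond
    ...   | inj₂ (k , (j<k , far-k) , k∉σ) = ⊥-elim (¬both
            ( subst (Shape j) (sym (del-id j∉σ)) (inj₁ a)
            , inj₁ (Cluster-add a k∉σ far-k (>⇒≢ 0<j) (<⇒≢ (subst (j <_) (sym M≡j+p) (m<m+n j 0<p)))
                                (<⇒≢ j<k))))

    Unmatched⇒Shape-suc : Unmatched (Shape j) j σ → Shape (suc j) σ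
    Unmatched⇒Shape-suc (inj₂ b , _) = inj₂ (Triple-weaken b (m<n⇒m<1+n (i<j b)))
    Unmatched⇒Shape-suc (inj₁ a , ¬both) with j + p <? M a
    ... | yes j+p<M = inj₁ (Cluster-weaken a j+p<M)
    ... | no j+p≮M = inj₂ (Cluster-tight a (≤-antisym (≮⇒≥ j+p≮M) (j+p≤M a)) ¬both)

    -- Deleting j leaves j outside, so a Shape j must be a Cluster whose window is [j, j + p].
    del-window : Shape j (del j σ) → Out σ k → k ≡ 0 ⊎ j ≤ k × k ≤ j + p
    del-window {σ = σ} (inj₂ b) _ =
      ⊥-elim (Out-In-disjoint (Out-del-self {σ = σ} j<n) (in-middle b _ (i<j b) j+p<n))
    del-window {σ = σ} {k = k} (inj₁ a) k∉σ with k ≟ 0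
    ... | yes k≡0 = inj₁ k≡0
    ... | no k≢0 = inj₂
          ( +-cancelʳ-≤ p j k (≤-trans (j+p≤M a) (Cluster-M≤+p a (Out-del k∉σ) (n≢0⇒n>0 k≢0)))
          , ≤-trans (Cluster-≤M a (Out-del k∉σ)) (Cluster-M≤+p a (Out-del-self {σ = σ} j<n) 0<j))

    Shape-suc⇒¬Shape-del×add : Shape (suc j) σ → ¬ (Shape j (del j σ) × Shape j (add j σ))
    Shape-suc⇒¬Shape-del×add (inj₁ a) (s-del , _) with del-window s-del (out-M a)
    ... | inj₁ M≡0 = >⇒≢ (≤-trans (s≤s z≤n) (j+p≤M a)) M≡0
    ... | inj₂ (_ , M≤j+p) = <⇒≱ (j+p≤M a) M≤j+p
    Shape-suc⇒¬Shape-del×add (inj₂ b) (s-del , s-add) with del-window s-del (out-i b)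
    ... | inj₁ i≡0 = >⇒≢ (≤-<-trans z≤n (Triple-p<i b)) i≡0
    ... | inj₂ (j≤i , _) = Triple-add-blocked b (≤-antisym (s≤s⁻¹ (i<j b)) j≤i) s-add

    Shape-step : Unmatched (Shape j) j σ ⇔ Shape (suc j) σ
    Shape-step = mk⇔ Unmatched⇒Shape-suc λ s → Shape-down s , Shape-suc⇒¬Shape-del×add s

  𝒞⇔Shape : ∀ j → 0 < j → j + p ≤ n → ∀ σ → 𝒞 n p j σ ⇔ Shape j σ
  𝒞⇔Shape 1 _ _ σ = 𝒞₁⇔Shape σ
  𝒞⇔Shape (suc (suc j)) _ 2+j+p≤n σ =
    ⇔-trans (Unmatched-cong (𝒞⇔Shape (suc j) z<s (<⇒≤ 2+j+p≤n))) (Step.Shape-step z<s 2+j+p≤n)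

  n∸p+p≡n : n ∸ p + p ≡ n
  n∸p+p≡n = m∸n+n≡m (<⇒≤ p<n)

  n∸2p+p+p≡n : n ∸ 2 * p + p + p ≡ n
  n∸2p+p+p≡n = trans (+-assoc (n ∸ 2 * p) p p)
    (trans (cong (λ q → n ∸ 2 * p + (p + q)) (sym (+-identityʳ p)))
           (m∸n+n≡m (≤-trans (*-monoˡ-≤ p (n≤1+n 2)) (<⇒≤ 3p<n))))

  n∸2p+p≡n∸p : n ∸ 2 * p + p ≡ n ∸ p
  n∸2p+p≡n∸p = +-cancelʳ-≡ p _ _ (trans n∸2p+p+p≡n (sym n∸p+p≡n))

  n∸p<n : n ∸ p < n
  n∸p<n = subst (n ∸ p <_) n∸p+p≡n (m<m+n _ 0<p)

  n∸2p<n∸p : n ∸ 2 * p < n ∸ p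
  n∸2p<n∸p = subst (n ∸ 2 * p <_) n∸2p+p≡n∸p (m<m+n _ 0<p)

  Corner : ℕ → Set
  Corner k = k ≡ 0 ⊎ k ≡ n ∸ 2 * p ⊎ k ≡ n ∸ p

  -- τ n p is definitionally excluding corner?.
  corner? : Decidable Corner
  corner? k = k ≟ 0 ⊎-dec k ≟ n ∸ 2 * p ⊎-dec k ≟ n ∸ p

  ¬Corner : k ≢ 0 → k ≢ n ∸ 2 * p → k ≢ n ∸ p → ¬ Corner k
  ¬Corner k≢0 k≢n∸2p k≢n∸p = [ k≢0 , [ k≢n∸2p , k≢n∸p ] ]

  ¬Cluster-last : ¬ Cluster (n ∸ p) σ
  ¬Cluster-last a = <⇒≱ (Out⇒<n (out-M a)) (subst (_≤ M a) n∸p+p≡n (j+p≤M a))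

  Triple-exact : (b : Triple j σ) → i b + p + p ≡ n → σ ≡ τ n p
  Triple-exact {σ = σ} b i+p+p≡n = ≡-excluding corner? out-corner in-rest
    where
    i+p≡n∸p : i b + p ≡ n ∸ p
    i+p≡n∸p = sym (trans (cong (_∸ p) (sym i+p+p≡n)) (m+n∸n≡m (i b + p) p))
    i≡n∸2p : i b ≡ n ∸ 2 * p
    i≡n∸2p = +-cancelʳ-≡ p _ _ (trans i+p≡n∸p (sym n∸2p+p≡n∸p))

    out-corner : ∀ k → Corner k → Out σ k
    out-corner _ (inj₁ refl) = out-0 b
    out-corner _ (inj₂ (inj₁ refl)) = subst (Out σ) i≡n∸2p (out-i b)
    out-corner _ (inj₂ (inj₂ refl)) = subst (Out σ) i+p≡n∸p (out-i+p b)

    in-rest : ∀ k → ¬ Corner k → In σ k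
    in-rest k ¬corner with <-cmp k (i b)
    ... | tri< k<i _ _ = in-below b k (n≢0⇒n>0 (¬corner ∘ inj₁)) k<i
    ... | tri≈ _ k≡i _ = contradiction (inj₂ (inj₁ (trans k≡i i≡n∸2p))) ¬corner
    ... | tri> _ _ i<k with <-cmp k (i b + p)
    ...   | tri< k<i+p _ _ = in-middle b k i<k (subst (k + p <_) i+p+p≡n (+-monoˡ-< p k<i+p))
    ...   | tri≈ _ k≡i+p _ = contradiction (inj₂ (inj₂ (trans k≡i+p i+p≡n∸p))) ¬corner
    ...   | tri> _ _ i+p<k = in-above b k i+p<k

  -- Unless i = n ∸ 2p, the label n ∸ p lies strictly between i and i + p and is free to toggle.
  Triple-last⇒τ : Triple (n ∸ p) σ →
                  ¬ (Shape (n ∸ p) (del (n ∸ p) σ) × Shape (n ∸ p) (add (n ∸ p) σ)) → σ ≡ τ n p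
  Triple-last⇒τ b ¬both with m≤n⇒m<n∨m≡n (n≤i+p+p b)
  ... | inj₂ n≡i+p+p = Triple-exact b (sym n≡i+p+p)
  ... | inj₁ n<i+p+p = ⊥-elim (¬both
        ( inj₂ (Triple-del b (i<j b) n∸p<i+p (≤-reflexive (sym n∸p+p≡n)))
        , inj₂ (Triple-add b (i<j b) n∸p<i+p)))
    where
    n∸p<i+p : n ∸ p < i b + p
    n∸p<i+p = +-cancelʳ-< p (n ∸ p) (i b + p) (subst (_< i b + p + p) (sym n∸p+p≡n) n<i+p+p)

  Triple-τ : Triple (n ∸ p) (τ n p)
  Triple-τ = record
    { i = n ∸ 2 * p ; i<j = n∸2p<n∸p ; n≤i+p+p = ≤-reflexive (sym n∸2p+p+p≡n) ; i+p<n = n∸2p+p<n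
    ; out-0 = Out-excluding corner? (≤-<-trans z≤n p<n) (inj₁ refl)
    ; out-i = Out-excluding corner? (<-trans n∸2p<n∸p n∸p<n) (inj₂ (inj₁ refl))
    ; out-i+p = Out-excluding corner? n∸2p+p<n (inj₂ (inj₂ n∸2p+p≡n∸p))
    ; in-below = λ k 0<k k<n∸2p → In-excluding corner?
        (¬Corner (>⇒≢ 0<k) (<⇒≢ k<n∸2p) (<⇒≢ (<-trans k<n∸2p n∸2p<n∸p)))
    ; in-middle = λ k n∸2p<k k+p<n → In-excluding corner?
        (¬Corner (>⇒≢ (≤-<-trans z≤n n∸2p<k)) (>⇒≢ n∸2p<k)
                 (<⇒≢ (+-cancelʳ-< p k (n ∸ p) (subst (k + p <_) (sym n∸p+p≡n) k+p<n))))
    ; in-above = λ k n∸2p+p<k → let n∸p<k = subst (_< k) n∸2p+p≡n∸p n∸2p+p<k in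
        In-excluding corner?
          (¬Corner (>⇒≢ (≤-<-trans z≤n n∸p<k)) (>⇒≢ (<-trans n∸2p<n∸p n∸p<k)) (>⇒≢ n∸p<k)) }
    where
    n∸2p+p<n : n ∸ 2 * p + p < n
    n∸2p+p<n = subst (_< n) (sym n∸2p+p≡n∸p) n∸p<n

  τ-add-last : ¬ Shape (n ∸ p) (add (n ∸ p) (τ n p))
  τ-add-last (inj₁ a) = ¬Cluster-last a
  τ-add-last (inj₂ b) with Out-add⁻ {σ = τ n p} (out-i b) | Out-add⁻ {σ = τ n p} (out-i+p b)
  ... | i∉τ , i≢n∸p | _ , i+p≢n∸p with Out-excluding⁻ corner? i∉τ
  ...   | inj₁ i≡0 = >⇒≢ (≤-<-trans z≤n (Triple-p<i b)) i≡0
  ...   | inj₂ (inj₁ i≡n∸2p) = i+p≢n∸p (trans (cong (_+ p) i≡n∸2p) n∸2p+p≡n∸p)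
  ...   | inj₂ (inj₂ i≡n∸p) = i≢n∸p i≡n∸p

  𝒞-last⇔ : ∀ σ → 𝒞 n p (suc (n ∸ p)) σ ⇔ Unmatched (Shape (n ∸ p)) (n ∸ p) σ
  𝒞-last⇔ _ = Unmatched-cong (𝒞⇔Shape (n ∸ p) (m<n⇒0<n∸m p<n) (≤-reflexive n∸p+p≡n))

  𝒞-last⇒τ : 𝒞 n p (suc (n ∸ p)) σ → σ ≡ τ n p
  𝒞-last⇒τ {σ} σ∈𝒞 with to (𝒞-last⇔ σ) σ∈𝒞
  ... | inj₁ a , _ = ⊥-elim (¬Cluster-last a)
  ... | inj₂ b , ¬both = Triple-last⇒τ b ¬both

  τ∈𝒞-last : 𝒞 n p (suc (n ∸ p)) (τ n p)
  τ∈𝒞-last = from (𝒞-last⇔ (τ n p)) (inj₂ Triple-τ , τ-add-last ∘ proj₂)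

lemma3p9 : (n p : ℕ) .{{_ : NonZero n}} → 1 ≤ p → 3 * p + 1 ≤ n →
    (σ : Subset n) → (𝒞 n p (n ∸ p + 1) σ → σ ≡ τ n p) × 𝒞 n p (n ∸ p + 1) (τ n p)
lemma3p9 n p 1≤p 3p+1≤n σ rewrite +-comm (n ∸ p) 1 = 𝒞-last⇒τ , τ∈𝒞-last
  where open Pruning n p 1≤p (subst (_≤ n) (+-comm (3 * p) 1) 3p+1≤n)
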